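{- Let $D=(E,\mathcal{F})$ be a vf-safe delta-matroid and $e\in E$. Then the value of $w(D^{\bullet|e})-w(D)$, for $\bullet\in\{*,\times,*\times,\times*,*\times*\}$ (listed in this order), depends on the type of $e$ in $D$ as follows: type $pp$: $+2,+1,+2,+2,+1$; type $uu$: $-2,0,-1,-1,0$; type $pu$: $0,0,+1,0,+1$; type $up$: $0,+1,0,+1,0$; type $tp$: $+1,+1,+1,0,-1$; type $tu$: $-1,0,0,-2,-1$; type $pt$: $+1,-1,0,+1,+1$; type $ut$: $-1,-1,-2,0,0$; type $tt$: $0,-1,-1,-1,-1$.
   Context: A set system is $D=(E,\mathcal{F})$ with $E$ finite and $\mathcal{F}$ a collection of subsets of $E$. A delta-matroid is a set system with $\mathcal{F}\neq\emptyset$ such that for all $X,Y\in\mathcal{F}$ and $u\in X\Delta Y$ there is $v\in X\Delta Y$ (possibly $v=u$) with $X\Delta\{u,v\}\in\mathcal{F}$. For $A\subseteq E$, $D^{*|A}=(E,\{A\Delta X:X\in\mathcal{F}\})$ and $D^*=D^{*|E}$. For $e\in E$, $D^{\times|e}=(E,\mathcal{F}\Delta\{F\cup e:F\in\mathcal{F},e\notin F\})$. For a word $a=a_1\cdots a_n$ in $\{*,\times\}$, $D^{a|e}$ means applying $a_1|e$, then $a_2|e$, etc. A delta-matroid is vf-safe if every sequence of twists and loop complementations applied to it yields a delta-matroid. The width $w(D)$ is the maximum size minus the minimum size of a feasible set. Let $\mathcal{F}_{min}(D)$ be the set of minimum-cardinality feasible sets. Element $e$ is a ribbon loop of $D$ if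 it lies in no set of $\mathcal{F}_{min}(D)$; a ribbon loop $e$ is non-orientable if it is also a ribbon loop of $D^{*|e}$, and orientable otherwise. The primal type of $e$ in $D$ is $p$ if $e$ is not a ribbon loop, $u$ if it is an orientable ribbon loop, and $t$ if it is a non-orientable ribbon loop. The dual type of $e$ in $D$ is the primal type of $e$ in $D^*$. The type of $e$ is the pair (primal type)(dual type), e.g. $pu$. -}

module Defs where

open import Data.Bool using (Bool; true; false; _xor_; _∧_; if_then_else_)
open import Data.Nat using (ℕ; zero; suc; _⊔_; _⊓_; _∸_)
open import Data.Integer using (ℤ; +_; -_)
open import Data.Fin using (Fin)
open import Data.Fin.Subset using (Subset; ⁅_⁆; _∪_; ∣_∣; _∈_; _∉_; _-_; ⊤)
open import Data.Fin.Subset.Properties using (_∈?_)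
open import Data.Vec using (Vec; []; _∷_; zipWith)
open import Data.List using (List; []; _∷_; _++_; map; foldr)
open import Data.Product using (Σ; _×_; ∃)
open import Relation.Binary.PropositionalEquality using (_≡_)
open import Relation.Nullary using (¬_; does)

-- Ground set E = Fin n.  A set system (E, 𝓕) is given by the
-- characteristic function of 𝓕 on the (finite) power set of E.
SetSystem : ℕ → Set
SetSystem n = Subset n → Bool

Feasible : ∀ {n} → SetSystem n → Subset n → Set
Feasible 𝓕 X = 𝓕 X ≡ true

_Δ_ : ∀ {n} → Subset n → Subset n → Subset n
X Δ Y = zipWith _xor_ X Y

IsDeltaMatroid : ∀ {n} → SetSystem n → Set
IsDeltaMatroid {n} 𝓕 =
  (∃ λ (X : Subset n) → Feasible 𝓕 X) ×
  (∀ (X Y : Subset n) → Feasible 𝓕 X → Feasible 𝓕 Y →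
     ∀ (u : Fin n) → u ∈ (X Δ Y) →
     ∃ λ (v : Fin n) → v ∈ (X Δ Y) × Feasible 𝓕 (X Δ (⁅ u ⁆ ∪ ⁅ v ⁆)))
-- {u,v} = ⁅ u ⁆ ∪ ⁅ v ⁆ (equal to {u} when v = u)

-- twist D^{*|A} = (E, {A Δ X : X ∈ 𝓕}):  Y ∈ new 𝓕  iff  A Δ Y ∈ 𝓕
twist : ∀ {n} → Subset n → SetSystem n → SetSystem n
twist A 𝓕 Y = 𝓕 (A Δ Y)

dual : ∀ {n} → SetSystem n → SetSystem n
dual = twist ⊤

-- loop complementation D^{×|e} : 𝓕 Δ {F ∪ e : F ∈ 𝓕, e ∉ F}.
-- Y ∈ {F ∪ e : F ∈ 𝓕, e ∉ F}  iff  e ∈ Y and Y - e ∈ 𝓕.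
loopCompl : ∀ {n} → Fin n → SetSystem n → SetSystem n
loopCompl e 𝓕 Y = 𝓕 Y xor (does (e ∈? Y) ∧ 𝓕 (Y - e))

-- twists and loop complementations, applied in sequence (head first)
data Operation (n : ℕ) : Set where
  twistOp : Subset n → Operation n
  loopOp  : Fin n → Operation n

applyOp : ∀ {n} → Operation n → SetSystem n → SetSystem n
applyOp (twistOp A) = twist A
applyOp (loopOp e)  = loopCompl e

applyOps : ∀ {n} → List (Operation n) → SetSystem n → SetSystem n
applyOps []       𝓕 = 𝓕
applyOps (o ∷ os) 𝓕 = applyOps os (applyOp o 𝓕)

IsVfSafe : ∀ {n} → SetSystem n → Set
-- (the empty sequence gives that D itself is a delta-matroid)
IsVfSafe 𝓕 = ∀ os → IsDeltaMatroid (applyOps os 𝓕)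

data Letter : Set where
  ⋆ ✕ : Letter

applyWord : ∀ {n} → List Letter → Fin n → SetSystem n → SetSystem n
applyWord []       e 𝓕 = 𝓕
applyWord (⋆ ∷ w) e 𝓕 = applyWord w e (twist ⁅ e ⁆ 𝓕)
applyWord (✕ ∷ w) e 𝓕 = applyWord w e (loopCompl e 𝓕)

allSubsets : ∀ n → List (Subset n)
allSubsets zero    = [] ∷ []
allSubsets (suc n) = map (true ∷_) (allSubsets n) ++ map (false ∷_) (allSubsets n)

-- minimum / maximum size of a feasible set (correct whenever 𝓕 ≠ ∅)
minSize : ∀ {n} → SetSystem n → ℕ
minSize {n} 𝓕 = foldr (λ X m → if 𝓕 X then ∣ X ∣ ⊓ m else m) n (allSubsets n)

maxSize : ∀ {n} → SetSystem n → ℕ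
maxSize {n} 𝓕 = foldr (λ X m → if 𝓕 X then ∣ X ∣ ⊔ m else m) 0 (allSubsets n)

width : ∀ {n} → SetSystem n → ℕ
width 𝓕 = maxSize 𝓕 ∸ minSize 𝓕

RibbonLoop : ∀ {n} → SetSystem n → Fin n → Set
RibbonLoop 𝓕 e = ∀ X → Feasible 𝓕 X → ∣ X ∣ ≡ minSize 𝓕 → e ∉ X

data ElemType : Set where
  p u t : ElemType

PrimalType : ∀ {n} → SetSystem n → Fin n → ElemType → Set
PrimalType 𝓕 e p = ¬ RibbonLoop 𝓕 e
PrimalType 𝓕 e u = RibbonLoop 𝓕 e × ¬ RibbonLoop (twist ⁅ e ⁆ 𝓕) e
PrimalType 𝓕 e t = RibbonLoop 𝓕 e × RibbonLoop (twist ⁅ e ⁆ 𝓕) e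

DualType : ∀ {n} → SetSystem n → Fin n → ElemType → Set
DualType 𝓕 e τ = PrimalType (dual 𝓕) e τ

data Bullet : Set where
  b* b× b*× b×* b*×* : Bullet

bulletWord : Bullet → List Letter
bulletWord b*   = ⋆ ∷ []
bulletWord b×   = ✕ ∷ []
bulletWord b*×  = ⋆ ∷ ✕ ∷ []
bulletWord b×*  = ✕ ∷ ⋆ ∷ []
bulletWord b*×* = ⋆ ∷ ✕ ∷ ⋆ ∷ []

private
  row : ℤ → ℤ → ℤ → ℤ → ℤ → Bullet → ℤ
  row a b c d f b*   = a
  row a b c d f b×   = b
  row a b c d f b*×  = c
  row a b c d f b×*  = d
  row a b c d f b*×* = f

widthChange : ElemType → ElemType → Bullet → ℤ
widthChange p p = row (+ 2) (+ 1) (+ 2) (+ 2) (+ 1)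
widthChange u u = row (- + 2) (+ 0) (- + 1) (- + 1) (+ 0)
widthChange p u = row (+ 0) (+ 0) (+ 1) (+ 0) (+ 1)
widthChange u p = row (+ 0) (+ 1) (+ 0) (+ 1) (+ 0)
widthChange t p = row (+ 1) (+ 1) (+ 1) (+ 0) (- + 1)
widthChange t u = row (- + 1) (+ 0) (+ 0) (- + 2) (- + 1)
widthChange p t = row (+ 1) (- + 1) (+ 0) (+ 1) (+ 1)
widthChange u t = row (- + 1) (- + 1) (- + 2) (+ 0) (+ 0)
widthChange t t = row (+ 0) (- + 1) (- + 1) (- + 1) (- + 1)

module Submission where

-- Fix e and sort the sets Y ∌ e into three slices of 𝓕: Y is in `absent` if Y ∈ 𝓕, in
-- `present` if Y ∪ e ∈ 𝓕, and in `exclusive` if exactly one of the two holds.  D and the five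
-- D^{•|e} are exactly the set systems whose sets avoiding e form one slice i while their sets
-- containing e, with e deleted, form a different slice j: a twist at e swaps i and j, a loop
-- complementation replaces j by the third slice, and passing to the dual swaps i and j and
-- exchanges absent with present.  By vf-safety all six are delta-matroids, and the symmetric
-- exchange axiom then forces two slices to share a minimum size k while the third, deficient,
-- slice has no set of size ≤ k.  Hence minSize D^{•|e} is k, plus 1 if i is the deficient
-- slice; e is a ribbon loop of D (of D^{*|e}) iff absent (present) is not deficient, so the
-- type of e names the deficient slices of D and D*; and w = n - minSize D - minSize D* turns
-- the table into a finite check.

open import Defs
open import Algebra.Definitions using (Selective)
open import Data.Bool using (Bool; true; false; not; _xor_; _∧_; _∨_; if_then_else_)
open import Data.Bool.Properties
  using (xor-assoc; xor-comm; xor-identityˡ; xor-identityʳ; xor-same; not-involutive;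
         ∨-zeroʳ; ⇔→≡)
  renaming (_≟_ to _≟ᵇ_)
open import Data.Nat using (ℕ; zero; suc; _+_; _≤_; _<_; _⊓_; _⊔_; _∸_; z≤n; s≤s)
open import Data.Nat.Properties
  using (≤-refl; ≤-reflexive; ≤-trans; ≤-antisym; ≤-pred; <⇒≱; <-irrefl; n≤1+n;
         m≤n⇒m<n∨m≡n; ⊓-sel; ⊔-sel; m⊓n≤m; m⊓n≤n; m≤m⊔n; m≤n⊔m; +-monoʳ-≤; +-monoˡ-≤;
         +-comm; +-assoc; +-identityʳ; m∸n+n≡m; module ≤-Reasoning)
open import Data.Nat.Tactic.RingSolver using (solve-∀)
open import Data.Integer using (+_; _-_; _⊖_)
open import Data.Integer.Properties using ([+m]-[+n]≡m⊖n; +-cancelˡ-⊖)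
open import Data.Fin using (Fin; zero; suc)
open import Data.Fin.Properties using () renaming (_≟_ to _≟ᶠ_)
open import Data.Fin.Subset using (Subset; ⁅_⁆; _∪_; ∣_∣; _∈_; ⊤; ⊥; ∁) renaming (_-_ to _∖_)
open import Data.Fin.Subset.Properties
  using (_∈?_; ∪-idem; ∪-identityˡ; ∪-identityʳ; p─⊥≡p; ∣∁p∣≡n∸∣p∣; ∣p∣≤n)
open import Data.List using (List; []; _∷_; map; foldr)
open import Data.List.Membership.Propositional using () renaming (_∈_ to _∈ₗ_)
open import Data.List.Membership.Propositional.Properties using (∈-map⁺; ∈-++⁺ˡ; ∈-++⁺ʳ)
open import Data.List.Relation.Unary.Any using (here; there)
open import Data.Vec using (lookup; _∷_; [])
open import Data.Vec.Properties
  using (lookup-zipWith; lookup-map; lookup⇒[]=; []=⇒lookup; ≡-dec; zipWith-assoc;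
         zipWith-comm; zipWith-identityˡ; zipWith-identityʳ; zipWith-replicate₁)
open import Data.Product using (∃; ∃₂; _×_; _,_; proj₁; proj₂; uncurry)
import Data.Product as Σ
open import Data.Sum using (_⊎_; inj₁; inj₂)
open import Function using (_∘_; id)
open import Function.Bundles using (_⇔_; mk⇔; module Equivalence)
open import Level using (0ℓ)
open import Relation.Binary.Core using (Rel)
open import Relation.Binary.Definitions using (DecidableEquality; Transitive)
open import Relation.Binary.PropositionalEquality
open import Relation.Nullary using (¬_; yes; no; does; contradiction)

open Equivalence using (to; from)

private variable
  n k : ℕ
  X Y : Subset n

-- Symmetric difference and toggling single elements

lookup-Δ : ∀ (X Y : Subset n) i → lookup (X Δ Y) i ≡ lookup X i xor lookup Y i
lookup-Δ X Y i = lookup-zipWith _xor_ i X Y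

Δ-assoc : ∀ (X Y Z : Subset n) → (X Δ Y) Δ Z ≡ X Δ (Y Δ Z)
Δ-assoc = zipWith-assoc xor-assoc

Δ-comm : ∀ (X Y : Subset n) → X Δ Y ≡ Y Δ X
Δ-comm = zipWith-comm xor-comm

Δ-identityˡ : ∀ (X : Subset n) → ⊥ Δ X ≡ X
Δ-identityˡ = zipWith-identityˡ xor-identityˡ

Δ-identityʳ : ∀ (X : Subset n) → X Δ ⊥ ≡ X
Δ-identityʳ = zipWith-identityʳ xor-identityʳ

xor-cancelˡ : ∀ x y → x xor (x xor y) ≡ y
xor-cancelˡ true  y = not-involutive y
xor-cancelˡ false y = refl

xor-cancelʳ : ∀ x y → (x xor y) xor y ≡ x
xor-cancelʳ x y =
  trans (xor-comm (x xor y) y) (trans (cong (y xor_) (xor-comm x y)) (xor-cancelˡ y x))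

Δ-cancelˡ : ∀ (X Y : Subset n) → X Δ (X Δ Y) ≡ Y
Δ-cancelˡ []      []      = refl
Δ-cancelˡ (x ∷ X) (y ∷ Y) = cong₂ _∷_ (xor-cancelˡ x y) (Δ-cancelˡ X Y)

Δ-swap : ∀ (X Y Z : Subset n) → X Δ (Y Δ Z) ≡ Y Δ (X Δ Z)
Δ-swap X Y Z = begin
  X Δ (Y Δ Z)  ≡⟨ Δ-assoc X Y Z ⟨
  (X Δ Y) Δ Z  ≡⟨ cong (_Δ Z) (Δ-comm X Y) ⟩
  (Y Δ X) Δ Z  ≡⟨ Δ-assoc Y X Z ⟩
  Y Δ (X Δ Z)  ∎
  where open ≡-Reasoning

⊤Δ≡∁ : ∀ (X : Subset n) → ⊤ Δ X ≡ ∁ X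
⊤Δ≡∁ = zipWith-replicate₁ _xor_ true

∣⊤Δp∣+∣p∣≡n : ∀ (X : Subset n) → ∣ ⊤ Δ X ∣ + ∣ X ∣ ≡ n
∣⊤Δp∣+∣p∣≡n {n} X = begin
  ∣ ⊤ Δ X ∣ + ∣ X ∣  ≡⟨ cong (λ Y → ∣ Y ∣ + ∣ X ∣) (⊤Δ≡∁ X) ⟩
  ∣ ∁ X ∣ + ∣ X ∣    ≡⟨ cong (_+ ∣ X ∣) (∣∁p∣≡n∸∣p∣ X) ⟩
  n ∸ ∣ X ∣ + ∣ X ∣  ≡⟨ m∸n+n≡m (∣p∣≤n X) ⟩
  n                  ∎
  where open ≡-Reasoning

lookup-⊤Δ : ∀ (X : Subset n) i → lookup (⊤ Δ X) i ≡ not (lookup X i)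
lookup-⊤Δ X i = trans (cong (λ Y → lookup Y i) (⊤Δ≡∁ X)) (lookup-map i not X)

lookup-true-false⇒≢ : ∀ (X : Subset n) {a b} → lookup X a ≡ true → lookup X b ≡ false → a ≢ b
lookup-true-false⇒≢ X Xa Xb refl with () ← trans (sym Xa) Xb

lookup-toggle-same : ∀ (w : Fin n) X → lookup (⁅ w ⁆ Δ X) w ≡ not (lookup X w)
lookup-toggle-same zero    (x ∷ X) = refl
lookup-toggle-same (suc w) (x ∷ X) = lookup-toggle-same w X

toggle-flips : ∀ (w : Fin n) X {b} → lookup X w ≡ b → lookup (⁅ w ⁆ Δ X) w ≡ not b
toggle-flips w X Xw = trans (lookup-toggle-same w X) (cong not Xw)

lookup-toggle-other : ∀ (w : Fin n) X {i} → w ≢ i → lookup (⁅ w ⁆ Δ X) i ≡ lookup X i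
lookup-toggle-other zero    (x ∷ X) {zero}  w≢i = contradiction refl w≢i
lookup-toggle-other zero    (x ∷ X) {suc i} _   = cong (λ Y → lookup Y i) (Δ-identityˡ X)
lookup-toggle-other (suc w) (x ∷ X) {zero}  _   = refl
lookup-toggle-other (suc w) (x ∷ X) {suc i} w≢i = lookup-toggle-other w X (w≢i ∘ cong suc)

lookup-toggle²-other : ∀ (w v : Fin n) X {i} → w ≢ i → v ≢ i →
                       lookup (⁅ v ⁆ Δ (⁅ w ⁆ Δ X)) i ≡ lookup X i
lookup-toggle²-other w v X w≢i v≢i =
  trans (lookup-toggle-other v _ v≢i) (lookup-toggle-other w X w≢i)

∣toggle∣-add : ∀ (w : Fin n) X → lookup X w ≡ false → ∣ ⁅ w ⁆ Δ X ∣ ≡ suc ∣ X ∣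
∣toggle∣-add zero    (false ∷ X) _ = cong (suc ∘ ∣_∣) (Δ-identityˡ X)
∣toggle∣-add (suc w) (true  ∷ X) h = cong suc (∣toggle∣-add w X h)
∣toggle∣-add (suc w) (false ∷ X) h = ∣toggle∣-add w X h

∣toggle∣-remove : ∀ (w : Fin n) X → lookup X w ≡ true → suc ∣ ⁅ w ⁆ Δ X ∣ ≡ ∣ X ∣
∣toggle∣-remove zero    (true  ∷ X) _ = cong (suc ∘ ∣_∣) (Δ-identityˡ X)
∣toggle∣-remove (suc w) (true  ∷ X) h = cong suc (∣toggle∣-remove w X h)
∣toggle∣-remove (suc w) (false ∷ X) h = ∣toggle∣-remove w X h

∣toggle²∣-remove : ∀ (w v : Fin n) X → lookup X w ≡ true → lookup (⁅ w ⁆ Δ X) v ≡ true →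
                   suc (suc ∣ ⁅ v ⁆ Δ (⁅ w ⁆ Δ X) ∣) ≡ ∣ X ∣
∣toggle²∣-remove w v X Xw Xv =
  trans (cong suc (∣toggle∣-remove v _ Xv)) (∣toggle∣-remove w X Xw)

∣toggle²∣-exchange : ∀ (w v : Fin n) X → lookup X w ≡ true → lookup X v ≡ false →
                     ∣ ⁅ v ⁆ Δ (⁅ w ⁆ Δ X) ∣ ≡ ∣ X ∣
∣toggle²∣-exchange w v X Xw Xv = trans (∣toggle∣-add v _ X′v) (∣toggle∣-remove w X Xw)
  where X′v = trans (lookup-toggle-other w X (lookup-true-false⇒≢ X Xw Xv)) Xv

remove≡toggle : ∀ (w : Fin n) X → lookup X w ≡ true → X ∖ w ≡ ⁅ w ⁆ Δ X
remove≡toggle zero    (true ∷ X) _ = cong (false ∷_) (trans (p─⊥≡p X) (sym (Δ-identityˡ X)))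
remove≡toggle (suc w) (x ∷ X)    h = cong (x ∷_) (remove≡toggle w X h)

does-∈? : ∀ (w : Fin n) X → does (w ∈? X) ≡ lookup X w
does-∈? zero    (true  ∷ X) = refl
does-∈? zero    (false ∷ X) = refl
does-∈? (suc w) (x ∷ X)     = does-∈? w X

⁅⁆∪⁅⁆≡⁅⁆Δ⁅⁆ : ∀ (w v : Fin n) → w ≢ v → ⁅ w ⁆ ∪ ⁅ v ⁆ ≡ ⁅ w ⁆ Δ ⁅ v ⁆
⁅⁆∪⁅⁆≡⁅⁆Δ⁅⁆ zero    zero    w≢v = contradiction refl w≢v
⁅⁆∪⁅⁆≡⁅⁆Δ⁅⁆ zero    (suc v) _   =
  cong (true ∷_) (trans (∪-identityˡ ⁅ v ⁆) (sym (Δ-identityˡ ⁅ v ⁆)))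
⁅⁆∪⁅⁆≡⁅⁆Δ⁅⁆ (suc w) zero    _   =
  cong (true ∷_) (trans (∪-identityʳ ⁅ w ⁆) (sym (Δ-identityʳ ⁅ w ⁆)))
⁅⁆∪⁅⁆≡⁅⁆Δ⁅⁆ (suc w) (suc v) w≢v = cong (false ∷_) (⁅⁆∪⁅⁆≡⁅⁆Δ⁅⁆ w v (w≢v ∘ cong suc))

Δ-pair : ∀ X (w v : Fin n) → (w ≡ v × X Δ (⁅ w ⁆ ∪ ⁅ v ⁆) ≡ ⁅ w ⁆ Δ X)
                             ⊎ (w ≢ v × X Δ (⁅ w ⁆ ∪ ⁅ v ⁆) ≡ ⁅ v ⁆ Δ (⁅ w ⁆ Δ X))
Δ-pair X w v with w ≟ᶠ v
... | yes refl = inj₁ (refl , trans (cong (X Δ_) (∪-idem ⁅ w ⁆)) (Δ-comm X ⁅ w ⁆))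
... | no w≢v   = inj₂ (w≢v , (begin
  X Δ (⁅ w ⁆ ∪ ⁅ v ⁆)  ≡⟨ cong (X Δ_) (⁅⁆∪⁅⁆≡⁅⁆Δ⁅⁆ w v w≢v) ⟩
  X Δ (⁅ w ⁆ Δ ⁅ v ⁆)  ≡⟨ Δ-comm X _ ⟩
  (⁅ w ⁆ Δ ⁅ v ⁆) Δ X  ≡⟨ cong (_Δ X) (Δ-comm ⁅ w ⁆ ⁅ v ⁆) ⟩
  (⁅ v ⁆ Δ ⁅ w ⁆) Δ X  ≡⟨ Δ-assoc ⁅ v ⁆ ⁅ w ⁆ X ⟩
  ⁅ v ⁆ Δ (⁅ w ⁆ Δ X)  ∎))
  where open ≡-Reasoning

∣p∣≤∣q∣∧p≢q⇒∃q∖p : ∀ (X Y : Subset n) → ∣ X ∣ ≤ ∣ Y ∣ → X ≢ Y →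
                   ∃ λ i → lookup Y i ≡ true × lookup X i ≡ false
∣p∣≤∣q∣∧p≢q⇒∃q∖p []          []          _         X≢Y = contradiction refl X≢Y
∣p∣≤∣q∣∧p≢q⇒∃q∖p (false ∷ X) (true  ∷ Y) _         _   = zero , refl , refl
∣p∣≤∣q∣∧p≢q⇒∃q∖p (true  ∷ X) (true  ∷ Y) (s≤s X≤Y) X≢Y =
  Σ.map suc id (∣p∣≤∣q∣∧p≢q⇒∃q∖p X Y X≤Y (X≢Y ∘ cong (true ∷_)))
∣p∣≤∣q∣∧p≢q⇒∃q∖p (false ∷ X) (false ∷ Y) X≤Y       X≢Y =
  Σ.map suc id (∣p∣≤∣q∣∧p≢q⇒∃q∖p X Y X≤Y (X≢Y ∘ cong (false ∷_)))
∣p∣≤∣q∣∧p≢q⇒∃q∖p (true  ∷ X) (false ∷ Y) X<Y       _   =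
  Σ.map suc id (∣p∣≤∣q∣∧p≢q⇒∃q∖p X Y (≤-trans (n≤1+n _) X<Y) (λ X≡Y → <-irrefl (cong ∣_∣ X≡Y) X<Y))

-- Minimum, maximum and width

∈-allSubsets : ∀ (X : Subset n) → X ∈ₗ allSubsets n
∈-allSubsets []          = here refl
∈-allSubsets (true  ∷ X) = ∈-++⁺ˡ (∈-map⁺ (true ∷_) (∈-allSubsets X))
∈-allSubsets (false ∷ X) = ∈-++⁺ʳ _ (∈-map⁺ (false ∷_) (∈-allSubsets X))

module _ (G : SetSystem n) (_∙_ : ℕ → ℕ → ℕ) where

  sizeFold : ℕ → List (Subset n) → ℕ
  sizeFold z = foldr (λ X m → if G X then ∣ X ∣ ∙ m else m) z

  sizeFold-bounded : ∀ {_≼_ : Rel ℕ 0ℓ} → Transitive _≼_ →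
                     (∀ a b → (a ∙ b) ≼ a) → (∀ a b → (a ∙ b) ≼ b) →
                     ∀ z {L X} → X ∈ₗ L → Feasible G X → sizeFold z L ≼ ∣ X ∣
  sizeFold-bounded ≼-trans ≼ˡ ≼ʳ z (here refl) GX rewrite GX = ≼ˡ _ _
  sizeFold-bounded ≼-trans ≼ˡ ≼ʳ z {Y ∷ L} (there X∈L) GX with G Y
  ... | true  = ≼-trans (≼ʳ _ _) (sizeFold-bounded ≼-trans ≼ˡ ≼ʳ z X∈L GX)
  ... | false = sizeFold-bounded ≼-trans ≼ˡ ≼ʳ z X∈L GX

  sizeFold-selects : Selective _≡_ _∙_ → ∀ z L →
                     sizeFold z L ≡ z ⊎ ∃ λ X → Feasible G X × ∣ X ∣ ≡ sizeFold z L
  sizeFold-selects sel z []      = inj₁ refl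
  sizeFold-selects sel z (Y ∷ L) with G Y in GY
  ... | false = sizeFold-selects sel z L
  ... | true with sel ∣ Y ∣ (sizeFold z L)
  ...   | inj₁ picks-Y = inj₂ (Y , GY , sym picks-Y)
  ...   | inj₂ picks-L with sizeFold-selects sel z L
  ...     | inj₁ base           = inj₁ (trans picks-L base)
  ...     | inj₂ (X , GX , ∣X∣) = inj₂ (X , GX , trans ∣X∣ (sym picks-L))

module _ (G : SetSystem n) where

  minSize-≤ : Feasible G X → minSize G ≤ ∣ X ∣
  minSize-≤ {X = X} = sizeFold-bounded G _⊓_ ≤-trans m⊓n≤m m⊓n≤n _ (∈-allSubsets X)

  maxSize-≥ : Feasible G X → ∣ X ∣ ≤ maxSize G
  maxSize-≥ {X = X} = sizeFold-bounded G _⊔_ (λ p q → ≤-trans q p) m≤m⊔n m≤n⊔m _ (∈-allSubsets X)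

  minSize-attained : Feasible G X → ∃ λ Y → Feasible G Y × ∣ Y ∣ ≡ minSize G
  minSize-attained {X = X} GX with sizeFold-selects G _⊓_ ⊓-sel n (allSubsets n)
  ... | inj₂ attained = attained
  ... | inj₁ min≡n    =
    X , GX , ≤-antisym (≤-trans (∣p∣≤n X) (≤-reflexive (sym min≡n))) (minSize-≤ GX)

  maxSize-attained : Feasible G X → ∃ λ Y → Feasible G Y × ∣ Y ∣ ≡ maxSize G
  maxSize-attained {X = X} GX with sizeFold-selects G _⊔_ ⊔-sel 0 (allSubsets n)
  ... | inj₂ attained = attained
  ... | inj₁ max≡0    = X , GX , ≤-antisym (maxSize-≥ GX) (≤-trans (≤-reflexive max≡0) z≤n)

  minSize-unique : ∀ {m} → Feasible G X → ∣ X ∣ ≡ m → (∀ Y → Feasible G Y → m ≤ ∣ Y ∣) →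
                   minSize G ≡ m
  minSize-unique GX ∣X∣≡m m≤ with minSize-attained GX
  ... | Y , GY , ∣Y∣≡min =
    ≤-antisym (≤-trans (minSize-≤ GX) (≤-reflexive ∣X∣≡m)) (≤-trans (m≤ Y GY) (≤-reflexive ∣Y∣≡min))

maxSize+minSize-dual : ∀ (G : SetSystem n) → Feasible G X → maxSize G + minSize (dual G) ≡ n
maxSize+minSize-dual {n} G GX with maxSize-attained G GX
... | Y , GY , ∣Y∣≡max = ≤-antisym upper lower
  where
  open ≤-Reasoning
  dual-feasible : ∀ {Z} → Feasible G Z → Feasible (dual G) (⊤ Δ Z)
  dual-feasible {Z} = subst (Feasible G) (sym (Δ-cancelˡ ⊤ Z))

  upper : maxSize G + minSize (dual G) ≤ n
  upper = begin
    maxSize G + minSize (dual G)  ≡⟨ cong (_+ minSize (dual G)) ∣Y∣≡max ⟨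
    ∣ Y ∣ + minSize (dual G)      ≤⟨ +-monoʳ-≤ ∣ Y ∣ (minSize-≤ (dual G) (dual-feasible GY)) ⟩
    ∣ Y ∣ + ∣ ⊤ Δ Y ∣             ≡⟨ +-comm ∣ Y ∣ _ ⟩
    ∣ ⊤ Δ Y ∣ + ∣ Y ∣             ≡⟨ ∣⊤Δp∣+∣p∣≡n Y ⟩
    n                             ∎

  lower : n ≤ maxSize G + minSize (dual G)
  lower with minSize-attained (dual G) (dual-feasible GX)
  ... | Z , G*Z , ∣Z∣≡min* = begin
    n                             ≡⟨ ∣⊤Δp∣+∣p∣≡n Z ⟨
    ∣ ⊤ Δ Z ∣ + ∣ Z ∣             ≤⟨ +-monoˡ-≤ ∣ Z ∣ (maxSize-≥ G G*Z) ⟩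
    maxSize G + ∣ Z ∣             ≡⟨ cong (λ m → maxSize G + m) ∣Z∣≡min* ⟩
    maxSize G + minSize (dual G)  ∎

width+minSizes : ∀ (G : SetSystem n) → Feasible G X → width G + (minSize G + minSize (dual G)) ≡ n
width+minSizes {n} G GX = begin
  width G + (minSize G + minSize (dual G))  ≡⟨ +-assoc (width G) (minSize G) (minSize (dual G)) ⟨
  width G + minSize G + minSize (dual G)    ≡⟨ cong (_+ minSize (dual G)) (m∸n+n≡m min≤max) ⟩
  maxSize G + minSize (dual G)              ≡⟨ maxSize+minSize-dual G GX ⟩
  n                                         ∎
  where
  open ≡-Reasoning
  min≤max = ≤-trans (minSize-≤ G GX) (maxSize-≥ G GX)

difference-swap : ∀ a b x y → a + x ≡ b + y → + a - + b ≡ + y - + x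
difference-swap a b x y a+x≡b+y = begin
  + a - + b          ≡⟨ [+m]-[+n]≡m⊖n a b ⟩
  a ⊖ b              ≡⟨ +-cancelˡ-⊖ x a b ⟨
  (x + a) ⊖ (x + b)  ≡⟨ cong₂ _⊖_ (trans (+-comm x a) a+x≡b+y) (+-comm x b) ⟩
  (b + y) ⊖ (b + x)  ≡⟨ +-cancelˡ-⊖ b y x ⟩
  y ⊖ x              ≡⟨ [+m]-[+n]≡m⊖n y x ⟨
  + y - + x          ∎
  where open ≡-Reasoning

width-difference : ∀ (G F : SetSystem n) {Y} → Feasible G X → Feasible F Y →
                   + width G - + width F
                     ≡ + (minSize F + minSize (dual F)) - + (minSize G + minSize (dual G))
width-difference G F GX FY =
  difference-swap (width G) (width F) _ _ (trans (width+minSizes G GX) (sym (width+minSizes F FY)))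

dual-vfSafe : ∀ {F : SetSystem n} → IsVfSafe F → IsVfSafe (dual F)
dual-vfSafe vf os = vf (twistOp ⊤ ∷ os)

-- Slices of a set system at an element

data Slice : Set where
  absent present exclusive : Slice

_≟_ : DecidableEquality Slice
absent    ≟ absent    = yes refl
present   ≟ present   = yes refl
exclusive ≟ exclusive = yes refl
absent    ≟ present   = no λ ()
absent    ≟ exclusive = no λ ()
present   ≟ absent    = no λ ()
present   ≟ exclusive = no λ ()
exclusive ≟ absent    = no λ ()
exclusive ≟ present   = no λ ()

private variable
  i j c : Slice

-- The value for equal arguments is never used.
third : Slice → Slice → Slice
third absent    present   = exclusive
third present   absent    = exclusive
third absent    exclusive = present
third exclusive absent    = present
third present   exclusive = absent
third exclusive present   = absent
third a         _         = a

third-distinct : i ≢ j → i ≢ third i j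
third-distinct {absent}    {absent}    i≢i = i≢i
third-distinct {present}   {present}   i≢i = i≢i
third-distinct {exclusive} {exclusive} i≢i = i≢i
third-distinct {absent}    {present}   _   = λ ()
third-distinct {absent}    {exclusive} _   = λ ()
third-distinct {present}   {absent}    _   = λ ()
third-distinct {present}   {exclusive} _   = λ ()
third-distinct {exclusive} {absent}    _   = λ ()
third-distinct {exclusive} {present}   _   = λ ()

dualSlice : Slice → Slice
dualSlice absent    = present
dualSlice present   = absent
dualSlice exclusive = exclusive

dualSlice-involutive : ∀ c → dualSlice (dualSlice c) ≡ c
dualSlice-involutive absent    = refl
dualSlice-involutive present   = refl
dualSlice-involutive exclusive = refl

dualSlice-distinct : i ≢ j → dualSlice j ≢ dualSlice i
dualSlice-distinct {i} {j} i≢j dj≡di =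
  i≢j (trans (sym (dualSlice-involutive i)) (trans (cong dualSlice (sym dj≡di)) (dualSlice-involutive j)))

act : List Letter → Slice × Slice → Slice × Slice
act []      ij      = ij
act (⋆ ∷ w) (i , j) = act w (j , i)
act (✕ ∷ w) (i , j) = act w (i , third i j)

typeOf : Slice → ElemType
typeOf absent    = p
typeOf present   = u
typeOf exclusive = t

δ : Slice → Slice → ℕ
δ i c = if does (i ≟ c) then 1 else 0

module _ {n} (e : Fin n) where

  slice : SetSystem n → Slice → Subset n → Bool
  slice F absent    Y = F Y
  slice F present   Y = F (⁅ e ⁆ Δ Y)
  slice F exclusive Y = F Y xor F (⁅ e ⁆ Δ Y)

  InSlice : SetSystem n → Slice → Subset n → Set
  InSlice F c Y = lookup Y e ≡ false × slice F c Y ≡ true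

  SliceBound : SetSystem n → Slice → ℕ → Set
  SliceBound F c k = ∀ Y → InSlice F c Y → k ≤ ∣ Y ∣

  slice-xor : ∀ F Z → i ≢ j → slice F i Z xor slice F j Z ≡ slice F (third i j) Z
  slice-xor {absent}    {absent}    F Z i≢j = contradiction refl i≢j
  slice-xor {present}   {present}   F Z i≢j = contradiction refl i≢j
  slice-xor {exclusive} {exclusive} F Z i≢j = contradiction refl i≢j
  slice-xor {absent}    {present}   F Z _   = refl
  slice-xor {present}   {absent}    F Z _   = xor-comm (F (⁅ e ⁆ Δ Z)) (F Z)
  slice-xor {absent}    {exclusive} F Z _   = xor-cancelˡ (F Z) (F (⁅ e ⁆ Δ Z))
  slice-xor {exclusive} {absent}    F Z _   =
    trans (xor-comm (F Z xor F (⁅ e ⁆ Δ Z)) (F Z)) (xor-cancelˡ (F Z) (F (⁅ e ⁆ Δ Z)))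
  slice-xor {present}   {exclusive} F Z _   =
    trans (xor-comm (F (⁅ e ⁆ Δ Z)) (F Z xor F (⁅ e ⁆ Δ Z))) (xor-cancelʳ (F Z) (F (⁅ e ⁆ Δ Z)))
  slice-xor {exclusive} {present}   F Z _   = xor-cancelʳ (F Z) (F (⁅ e ⁆ Δ Z))

  -- ⁅ e ⁆ Δ (⊤ Δ Y) is the complement of Y in E - e.
  slice-dual : ∀ F c Y → slice (dual F) (dualSlice c) Y ≡ slice F c (⁅ e ⁆ Δ (⊤ Δ Y))
  slice-dual F absent    Y = cong F (Δ-swap ⊤ ⁅ e ⁆ Y)
  slice-dual F present   Y = cong F (sym (Δ-cancelˡ ⁅ e ⁆ (⊤ Δ Y)))
  slice-dual F exclusive Y = trans (xor-comm (F (⊤ Δ Y)) _)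
    (cong₂ _xor_ (cong F (Δ-swap ⊤ ⁅ e ⁆ Y)) (cong F (sym (Δ-cancelˡ ⁅ e ⁆ (⊤ Δ Y)))))

  record Represents (G F : SetSystem n) (i j : Slice) : Set where
    field
      distinct   : i ≢ j
      avoiding   : ∀ Y → lookup Y e ≡ false → G Y ≡ slice F i Y
      containing : ∀ Y → lookup Y e ≡ false → G (⁅ e ⁆ Δ Y) ≡ slice F j Y

    feasible-avoiding : ∀ {Y} → InSlice F i Y → Feasible G Y
    feasible-avoiding (e∉Y , Y∈i) = trans (avoiding _ e∉Y) Y∈i

    feasible-containing : ∀ {Y} → InSlice F j Y → Feasible G (⁅ e ⁆ Δ Y)
    feasible-containing (e∉Y , Y∈j) = trans (containing _ e∉Y) Y∈j

    inSlice-avoiding : ∀ {Y} → Feasible G Y → lookup Y e ≡ false → InSlice F i Y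
    inSlice-avoiding {Y} GY e∉Y = e∉Y , trans (sym (avoiding Y e∉Y)) GY

    inSlice-containing : ∀ {Y} → Feasible G Y → lookup Y e ≡ true → InSlice F j (⁅ e ⁆ Δ Y)
    inSlice-containing {Y} GY e∈Y =
      e∉Y′ , trans (sym (containing _ e∉Y′)) (trans (cong G (Δ-cancelˡ ⁅ e ⁆ Y)) GY)
      where e∉Y′ = toggle-flips e Y e∈Y

    size-avoiding : SliceBound F i k → ∀ {Y} → Feasible G Y → lookup Y e ≡ false → k ≤ ∣ Y ∣
    size-avoiding bound GY e∉Y = bound _ (inSlice-avoiding GY e∉Y)

    size-containing : SliceBound F j k → ∀ {Y} → Feasible G Y → lookup Y e ≡ true →
                      suc k ≤ ∣ Y ∣
    size-containing bound {Y} GY e∈Y =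
      ≤-trans (s≤s (bound _ (inSlice-containing GY e∈Y))) (≤-reflexive (∣toggle∣-remove e Y e∈Y))

    size-bound : ∀ {m} → SliceBound F i m → SliceBound F j k → m ≤ suc k →
                 ∀ {Y} → Feasible G Y → m ≤ ∣ Y ∣
    size-bound bound-i bound-j m≤1+k {Y} GY with lookup Y e in eY
    ... | false = size-avoiding bound-i GY eY
    ... | true  = ≤-trans m≤1+k (size-containing bound-j GY eY)

  open Represents

  represents-self : ∀ F → Represents F F absent present
  represents-self F = record { distinct = λ () ; avoiding = λ _ _ → refl ; containing = λ _ _ → refl }

  represents-twist : ∀ {G F} → Represents G F i j → Represents (twist ⁅ e ⁆ G) F j i
  represents-twist {G = G} R = record
    { distinct   = distinct R ∘ sym
    ; avoiding   = containing R
    ; containing = λ Y e∉Y → trans (cong G (Δ-cancelˡ ⁅ e ⁆ Y)) (avoiding R Y e∉Y)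
    }

  represents-loopCompl : ∀ {G F} → Represents G F i j → Represents (loopCompl e G) F i (third i j)
  represents-loopCompl {i} {j} {G} {F} R = record
    { distinct   = third-distinct (distinct R)
    ; avoiding   = λ Y e∉Y → begin
        G Y xor (does (e ∈? Y) ∧ G (Y ∖ e))
          ≡⟨ cong (λ b → G Y xor (b ∧ G (Y ∖ e))) (trans (does-∈? e Y) e∉Y) ⟩
        G Y xor false
          ≡⟨ xor-identityʳ (G Y) ⟩
        G Y
          ≡⟨ avoiding R Y e∉Y ⟩
        slice F i Y ∎
    ; containing = λ Y e∉Y → let Y⁺ = ⁅ e ⁆ Δ Y ; e∈Y⁺ = toggle-flips e Y e∉Y in begin
        G Y⁺ xor (does (e ∈? Y⁺) ∧ G (Y⁺ ∖ e))
          ≡⟨ cong (λ b → G Y⁺ xor (b ∧ G (Y⁺ ∖ e))) (trans (does-∈? e Y⁺) e∈Y⁺) ⟩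
        G Y⁺ xor G (Y⁺ ∖ e)
          ≡⟨ cong (λ Z → G Y⁺ xor G Z) (trans (remove≡toggle e Y⁺ e∈Y⁺) (Δ-cancelˡ ⁅ e ⁆ Y)) ⟩
        G Y⁺ xor G Y
          ≡⟨ cong₂ _xor_ (containing R Y e∉Y) (avoiding R Y e∉Y) ⟩
        slice F j Y xor slice F i Y
          ≡⟨ xor-comm (slice F j Y) _ ⟩
        slice F i Y xor slice F j Y
          ≡⟨ slice-xor F Y (distinct R) ⟩
        slice F (third i j) Y ∎
    }
    where open ≡-Reasoning

  represents-dual : ∀ {G F} → Represents G F i j →
                    Represents (dual G) (dual F) (dualSlice j) (dualSlice i)
  represents-dual {i} {j} {G} {F} R = record
    { distinct   = dualSlice-distinct (distinct R)
    ; avoiding   = λ Y e∉Y → begin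
        G (⊤ Δ Y)                       ≡⟨ cong G (Δ-cancelˡ ⁅ e ⁆ (⊤ Δ Y)) ⟨
        G (⁅ e ⁆ Δ (⁅ e ⁆ Δ (⊤ Δ Y)))   ≡⟨ containing R _ (e∉complement Y e∉Y) ⟩
        slice F j (⁅ e ⁆ Δ (⊤ Δ Y))     ≡⟨ slice-dual F j Y ⟨
        slice (dual F) (dualSlice j) Y  ∎
    ; containing = λ Y e∉Y → begin
        G (⊤ Δ (⁅ e ⁆ Δ Y))             ≡⟨ cong G (Δ-swap ⊤ ⁅ e ⁆ Y) ⟩
        G (⁅ e ⁆ Δ (⊤ Δ Y))             ≡⟨ avoiding R _ (e∉complement Y e∉Y) ⟩
        slice F i (⁅ e ⁆ Δ (⊤ Δ Y))     ≡⟨ slice-dual F i Y ⟨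
        slice (dual F) (dualSlice i) Y  ∎
    }
    where
    open ≡-Reasoning
    e∉complement : ∀ Y → lookup Y e ≡ false → lookup (⁅ e ⁆ Δ (⊤ Δ Y)) e ≡ false
    e∉complement Y e∉Y = toggle-flips e (⊤ Δ Y) (trans (lookup-⊤Δ Y e) (cong not e∉Y))

  represents-applyWord : ∀ {G F} w → Represents G F i j →
                         uncurry (Represents (applyWord w e G) F) (act w (i , j))
  represents-applyWord []      R = R
  represents-applyWord (⋆ ∷ w) R = represents-applyWord w (represents-twist R)
  represents-applyWord (✕ ∷ w) R = represents-applyWord w (represents-loopCompl R)

  letterOp : Letter → Operation n
  letterOp ⋆ = twistOp ⁅ e ⁆
  letterOp ✕ = loopOp e

  applyWord≡applyOps : ∀ w F → applyWord w e F ≡ applyOps (map letterOp w) F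
  applyWord≡applyOps []      F = refl
  applyWord≡applyOps (⋆ ∷ w) F = applyWord≡applyOps w (twist ⁅ e ⁆ F)
  applyWord≡applyOps (✕ ∷ w) F = applyWord≡applyOps w (loopCompl e F)

  applyWord-deltaMatroid : ∀ {F} → IsVfSafe F → ∀ w → IsDeltaMatroid (applyWord w e F)
  applyWord-deltaMatroid {F} vf w =
    subst IsDeltaMatroid (sym (applyWord≡applyOps w F)) (vf (map letterOp w))

  realisable : i ≢ j → ∃ λ w → act w (absent , present) ≡ (i , j)
  realisable {absent}    {absent}    i≢j = contradiction refl i≢j
  realisable {present}   {present}   i≢j = contradiction refl i≢j
  realisable {exclusive} {exclusive} i≢j = contradiction refl i≢j
  realisable {absent}    {present}   _   = [] , refl
  realisable {present}   {absent}    _   = ⋆ ∷ [] , refl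
  realisable {absent}    {exclusive} _   = ✕ ∷ [] , refl
  realisable {present}   {exclusive} _   = ⋆ ∷ ✕ ∷ [] , refl
  realisable {exclusive} {absent}    _   = ✕ ∷ ⋆ ∷ [] , refl
  realisable {exclusive} {present}   _   = ⋆ ∷ ✕ ∷ ⋆ ∷ [] , refl

  deltaMatroid-representing : ∀ {F} → IsVfSafe F → i ≢ j →
                              ∃ λ G → Represents G F i j × IsDeltaMatroid G
  deltaMatroid-representing {F = F} vf i≢j with realisable i≢j
  ... | w , act-w≡ij =
    applyWord w e F ,
    subst (uncurry (Represents (applyWord w e F) F)) act-w≡ij (represents-applyWord w (represents-self F)) ,
    applyWord-deltaMatroid vf w

  -- The exchange argument

  -- Exchanging w ∈ Y ∖ X can only bring in some v ∈ X ∖ Y other than e: every other outcome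
  -- would be a feasible set violating one of the two size bounds.
  exchange-toward : ∀ {G} → IsDeltaMatroid G →
                    (∀ {Z} → Feasible G Z → lookup Z e ≡ false → k ≤ ∣ Z ∣) →
                    (∀ {Z} → Feasible G Z → lookup Z e ≡ true → suc k ≤ ∣ Z ∣) →
                    Feasible G Y → lookup Y e ≡ false → ∣ Y ∣ ≡ k → Feasible G X →
                    ∀ {w} → lookup Y w ≡ true → lookup X w ≡ false →
                    ∃ λ v → v ≢ e × lookup Y v ≡ false × lookup X v ≡ true ×
                            Feasible G (⁅ v ⁆ Δ (⁅ w ⁆ Δ Y))
  exchange-toward {k} {Y} {X} {G} (_ , exchange) avoid-bound contain-bound GY e∉Y ∣Y∣≡k GX {w} Yw Xw =
    choose (exchange Y X GY GX w (lookup⇒[]= w (Y Δ X) (trans (lookup-Δ Y X w) (cong₂ _xor_ Yw Xw))))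
    where
    Y₁ = ⁅ w ⁆ Δ Y
    w≢e = lookup-true-false⇒≢ Y Yw e∉Y
    e∉Y₁ = trans (lookup-toggle-other w Y w≢e) e∉Y
    1+∣Y₁∣≡k = trans (∣toggle∣-remove w Y Yw) ∣Y∣≡k

    not-one-removed : ¬ Feasible G Y₁
    not-one-removed GY₁ = <⇒≱ (≤-reflexive 1+∣Y₁∣≡k) (avoid-bound GY₁ e∉Y₁)

    not-two-removed : ∀ {v} → w ≢ v → lookup Y v ≡ true → ¬ Feasible G (⁅ v ⁆ Δ Y₁)
    not-two-removed {v} w≢v Yv GY₂ = <⇒≱ ∣Y₂∣<k (avoid-bound GY₂ e∉Y₂)
      where
      e∉Y₂ = trans (lookup-toggle²-other w v Y w≢e (lookup-true-false⇒≢ Y Yv e∉Y)) e∉Y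
      Y₁v = trans (lookup-toggle-other w Y w≢v) Yv
      ∣Y₂∣<k = ≤-trans (n≤1+n _) (≤-reflexive (trans (∣toggle²∣-remove w v Y Yw Y₁v) ∣Y∣≡k))

    not-e-added : ¬ Feasible G (⁅ e ⁆ Δ Y₁)
    not-e-added GY₂ = <⇒≱ (contain-bound GY₂ (toggle-flips e Y₁ e∉Y₁)) (≤-reflexive ∣Y₂∣≡k)
      where ∣Y₂∣≡k = trans (∣toggle²∣-exchange w e Y Yw e∉Y) ∣Y∣≡k

    choose : (∃ λ v → v ∈ (Y Δ X) × Feasible G (Y Δ (⁅ w ⁆ ∪ ⁅ v ⁆))) →
             ∃ λ v → v ≢ e × lookup Y v ≡ false × lookup X v ≡ true × Feasible G (⁅ v ⁆ Δ Y₁)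
    choose (v , v∈YΔX , G-exchanged) with Δ-pair Y w v
    ... | inj₁ (refl , Y-exchanged) =
      contradiction (subst (Feasible G) Y-exchanged G-exchanged) not-one-removed
    ... | inj₂ (w≢v , Y-exchanged) with subst (Feasible G) Y-exchanged G-exchanged | lookup Y v in Yv
    ...   | GY₂ | true  = contradiction GY₂ (not-two-removed w≢v Yv)
    ...   | GY₂ | false with v ≟ᶠ e
    ...     | yes refl = contradiction GY₂ not-e-added
    ...     | no v≢e   = v , v≢e , Yv , Xv , GY₂
      where
      Xv = trans (cong (_xor lookup X v) (sym Yv)) (trans (sym (lookup-Δ Y X v)) ([]=⇒lookup v∈YΔX))

  -- Induction on ∣ X Δ Y ∣: each exchange-toward step keeps Y in slice i and of size k.
  inSlice-transfer : ∀ {G F} → Represents G F i j → IsDeltaMatroid G →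
                     SliceBound F i k → SliceBound F j k →
                     InSlice F j X → ∣ X ∣ ≡ k → InSlice F i Y → ∣ Y ∣ ≡ k → InSlice F i X
  inSlice-transfer {i} {j} {k} {X} {Y} {G} {F} R dm bound-i bound-j X∈j ∣X∣≡k Y∈i ∣Y∣≡k =
    go (suc ∣ X Δ Y ∣) ≤-refl Y∈i ∣Y∣≡k
    where
    go : ∀ d {Y} → ∣ X Δ Y ∣ < d → InSlice F i Y → ∣ Y ∣ ≡ k → InSlice F i X
    go (suc d) {Y} XΔY<d Y∈i ∣Y∣≡k with ≡-dec _≟ᵇ_ Y X
    ... | yes refl = Y∈i
    ... | no Y≢X with ∣p∣≤∣q∣∧p≢q⇒∃q∖p X Y (≤-reflexive (trans ∣X∣≡k (sym ∣Y∣≡k))) (Y≢X ∘ sym)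
    ...   | _ , Yw , Xw = step Yw Xw (lookup-true-false⇒≢ Y Yw (proj₁ Y∈i))
      where
      step : ∀ {w} → lookup Y w ≡ true → lookup X w ≡ false → w ≢ e → InSlice F i X
      step {w} Yw Xw w≢e
        with exchange-toward dm (size-avoiding R bound-i) (size-containing R bound-j)
               (feasible-avoiding R Y∈i) (proj₁ Y∈i) ∣Y∣≡k (feasible-containing R X∈j)
               Yw (trans (lookup-toggle-other e X (w≢e ∘ sym)) Xw)
      ... | v , v≢e , Yv , X⁺v , GY′ = go d ∣XΔY′∣<d (inSlice-avoiding R GY′ e∉Y′) ∣Y′∣≡k
        where
        Y′ = ⁅ v ⁆ Δ (⁅ w ⁆ Δ Y)
        e∉Y′ = trans (lookup-toggle²-other w v Y w≢e v≢e) (proj₁ Y∈i)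
        ∣Y′∣≡k = trans (∣toggle²∣-exchange w v Y Yw Yv) ∣Y∣≡k
        Xv = trans (sym (lookup-toggle-other e X (v≢e ∘ sym))) X⁺v
        XΔY-w = trans (lookup-Δ X Y w) (cong₂ _xor_ Xw Yw)
        XΔY-v = trans (lookup-toggle-other w (X Δ Y) (lookup-true-false⇒≢ Y Yw Yv))
                      (trans (lookup-Δ X Y v) (cong₂ _xor_ Xv Yv))
        XΔY′≡ : X Δ Y′ ≡ ⁅ v ⁆ Δ (⁅ w ⁆ Δ (X Δ Y))
        XΔY′≡ = trans (Δ-swap X ⁅ v ⁆ _) (cong (⁅ v ⁆ Δ_) (Δ-swap X ⁅ w ⁆ Y))
        ∣XΔY′∣<d : ∣ X Δ Y′ ∣ < d
        ∣XΔY′∣<d = ≤-trans (n≤1+n _) (≤-trans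
          (≤-reflexive (trans (cong (λ Z → suc (suc ∣ Z ∣)) XΔY′≡) (∣toggle²∣-remove w v (X Δ Y) XΔY-w XΔY-v)))
          (≤-pred XΔY<d))

  -- A set of size k in the third slice lies in exactly one of the slices a and b, but
  -- inSlice-transfer moves it into both.
  third-deficient : ∀ {F a b} → IsVfSafe F → a ≢ b → (∀ x → SliceBound F x k) →
                    InSlice F a Y → InSlice F b Y → ∣ Y ∣ ≡ k → SliceBound F (third a b) (suc k)
  third-deficient {k} {Y} {F} {a} {b} vf a≢b bounded Y∈a Y∈b ∣Y∣≡k Z (e∉Z , Z∈third)
    with m≤n⇒m<n∨m≡n (bounded (third a b) Z (e∉Z , Z∈third))
  ... | inj₁ k<∣Z∣ = k<∣Z∣
  ... | inj₂ k≡∣Z∣ = contradiction false≡true λ ()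
    where
    transferred : ∀ {x y} → x ≢ y → InSlice F x Y → slice F y Z ≡ true → slice F x Z ≡ true
    transferred {x} {y} x≢y Y∈x Z∈y with deltaMatroid-representing vf x≢y
    ... | _ , R , dm =
      proj₂ (inSlice-transfer R dm (bounded x) (bounded y) (e∉Z , Z∈y) (sym k≡∣Z∣) Y∈x ∣Y∣≡k)

    false≡true : false ≡ true
    false≡true = begin
      false                        ≡⟨ xor-same (slice F a Z) ⟨
      slice F a Z xor slice F a Z  ≡⟨ cong (slice F a Z xor_) a⇔b ⟩
      slice F a Z xor slice F b Z  ≡⟨ slice-xor F Z a≢b ⟩
      slice F (third a b) Z        ≡⟨ Z∈third ⟩
      true                         ∎
      where
      open ≡-Reasoning
      a⇔b = ⇔→≡ (mk⇔ (transferred (a≢b ∘ sym) Y∈b) (transferred a≢b Y∈a))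

  record Deficiency (F : SetSystem n) (c : Slice) (k : ℕ) : Set where
    field
      attained  : ∀ x → x ≢ c → ∃ λ Y → InSlice F x Y × ∣ Y ∣ ≡ k
      bounded   : ∀ x → SliceBound F x k
      deficient : SliceBound F c (suc k)

  open Deficiency

  erased : SetSystem n → SetSystem n
  erased F Y = not (lookup Y e) ∧ (F Y ∨ F (⁅ e ⁆ Δ Y))

  inSlice-erased : ∀ F c Y → InSlice F c Y → Feasible (erased F) Y
  inSlice-erased F c Y (e∉Y , Y∈c) rewrite e∉Y = feasible-on-either-side c Y∈c
    where
    feasible-on-either-side : ∀ c → slice F c Y ≡ true → F Y ∨ F (⁅ e ⁆ Δ Y) ≡ true
    feasible-on-either-side absent    Y∈c = cong (_∨ F (⁅ e ⁆ Δ Y)) Y∈c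
    feasible-on-either-side present   Y∈c = trans (cong (F Y ∨_) Y∈c) (∨-zeroʳ (F Y))
    feasible-on-either-side exclusive Y∈c with F Y
    ... | true  = refl
    ... | false = Y∈c

  erased-nonempty : ∀ F → Feasible F X → ∃ λ Y → Feasible (erased F) Y
  erased-nonempty {X} F FX with lookup X e in eX
  ... | false = X , inSlice-erased F absent X (eX , FX)
  ... | true  = ⁅ e ⁆ Δ X , inSlice-erased F present (⁅ e ⁆ Δ X)
                               (toggle-flips e X eX , trans (cong F (Δ-cancelˡ ⁅ e ⁆ X)) FX)

  -- m is the least size of a set in any slice, and a set of size m lies in two slices.
  deficiency : ∀ {F} → IsVfSafe F → ∃₂ λ c k → Deficiency F c k
  deficiency {F} vf with erased-nonempty F (proj₂ (proj₁ (vf [])))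
  ... | Y , Y∈erased = deficiency-at (minSize-attained (erased F) {X = Y} Y∈erased)
    where
    m = minSize (erased F)

    bounded-by-m : ∀ x → SliceBound F x m
    bounded-by-m x Z Z∈x = minSize-≤ (erased F) {X = Z} (inSlice-erased F x Z Z∈x)

    third-of : ∀ {a b Y} → a ≢ b → ∣ Y ∣ ≡ m → InSlice F a Y → InSlice F b Y →
               (∀ x → x ≢ third a b → x ≡ a ⊎ x ≡ b) → Deficiency F (third a b) m
    third-of {a} {b} {Y} a≢b ∣Y∣≡m Y∈a Y∈b a-or-b = record
      { attained  = λ x x≢c → witness (a-or-b x x≢c)
      ; bounded   = bounded-by-m
      ; deficient = third-deficient vf a≢b bounded-by-m Y∈a Y∈b ∣Y∣≡m
      }
      where
      witness : ∀ {x} → x ≡ a ⊎ x ≡ b → ∃ λ Z → InSlice F x Z × ∣ Z ∣ ≡ m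
      witness (inj₁ refl) = Y , Y∈a , ∣Y∣≡m
      witness (inj₂ refl) = Y , Y∈b , ∣Y∣≡m

    deficiency-at : (∃ λ Y → Feasible (erased F) Y × ∣ Y ∣ ≡ m) → ∃₂ λ c k → Deficiency F c k
    deficiency-at (Y , Y∈erased , ∣Y∣≡m) with lookup Y e in eY | F Y in FY | F (⁅ e ⁆ Δ Y) in F⁺Y
    ... | true  | _     | _     with () ← Y∈erased
    ... | false | false | false with () ← Y∈erased
    ... | false | true  | true  =
      _ , _ , third-of {absent} {present} (λ ()) ∣Y∣≡m (eY , FY) (eY , F⁺Y)
        λ { absent _ → inj₁ refl ; present _ → inj₂ refl ; exclusive x≢c → contradiction refl x≢c }
    ... | false | true  | false =
      _ , _ , third-of {absent} {exclusive} (λ ()) ∣Y∣≡m (eY , FY) (eY , cong₂ _xor_ FY F⁺Y)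
        λ { absent _ → inj₁ refl ; exclusive _ → inj₂ refl ; present x≢c → contradiction refl x≢c }
    ... | false | false | true  =
      _ , _ , third-of {present} {exclusive} (λ ()) ∣Y∣≡m (eY , F⁺Y) (eY , cong₂ _xor_ FY F⁺Y)
        λ { present _ → inj₁ refl ; exclusive _ → inj₂ refl ; absent x≢c → contradiction refl x≢c }

  -- Minimum sizes, ribbon loops and types

  module _ {G F} (R : Represents G F i j) (D : Deficiency F c k) where

    minSize-nondeficient : i ≢ c → minSize G ≡ k
    minSize-nondeficient i≢c with attained D i i≢c
    ... | Y , Y∈i , ∣Y∣≡k = minSize-unique G (feasible-avoiding R Y∈i) ∣Y∣≡k
                              (λ _ → size-bound R (bounded D i) (bounded D j) (n≤1+n k))

    minSize-deficient : i ≡ c → minSize G ≡ suc k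
    minSize-deficient refl with attained D j (distinct R ∘ sym)
    ... | Y , Y∈j , ∣Y∣≡k = minSize-unique G (feasible-containing R Y∈j) ∣Y⁺∣≡1+k
                              (λ _ → size-bound R (deficient D) (bounded D j) ≤-refl)
      where ∣Y⁺∣≡1+k = trans (∣toggle∣-add e Y (proj₁ Y∈j)) (cong suc ∣Y∣≡k)

    ribbonLoop⇔nondeficient : RibbonLoop G e ⇔ i ≢ c
    ribbonLoop⇔nondeficient = mk⇔ nondeficient loop
      where
      nondeficient : RibbonLoop G e → i ≢ c
      nondeficient e-loop i≡c with attained D j (λ j≡c → distinct R (trans i≡c (sym j≡c)))
      ... | Y , Y∈j , ∣Y∣≡k = e-loop (⁅ e ⁆ Δ Y) (feasible-containing R Y∈j) ∣Y⁺∣≡min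
                                (lookup⇒[]= e _ (toggle-flips e Y (proj₁ Y∈j)))
        where
        ∣Y⁺∣≡min = trans (∣toggle∣-add e Y (proj₁ Y∈j))
                          (trans (cong suc ∣Y∣≡k) (sym (minSize-deficient i≡c)))

      loop : i ≢ c → RibbonLoop G e
      loop i≢c X GX ∣X∣≡min e∈X =
        <⇒≱ (size-containing R (bounded D j) GX ([]=⇒lookup e∈X))
            (≤-reflexive (trans ∣X∣≡min (minSize-nondeficient i≢c)))

  minSize-represented : ∀ {G F} → Represents G F i j → Deficiency F c k → minSize G ≡ k + δ i c
  minSize-represented {i} {c = c} {k} R D with i ≟ c
  ... | yes i≡c = trans (minSize-deficient R D i≡c) (+-comm 1 k)
  ... | no  i≢c = trans (minSize-nondeficient R D i≢c) (sym (+-identityʳ k))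

  minSizes-represented : ∀ {G F c′ k′} → Represents G F i j →
                         Deficiency F c k → Deficiency (dual F) c′ k′ →
                         minSize G + minSize (dual G) ≡ (k + δ i c) + (k′ + δ (dualSlice j) c′)
  minSizes-represented R D D′ =
    cong₂ _+_ (minSize-represented R D) (minSize-represented (represents-dual R) D′)

  ribbonLoop⇔ : ∀ {F} → Deficiency F c k → RibbonLoop F e ⇔ absent ≢ c
  ribbonLoop⇔ {F = F} = ribbonLoop⇔nondeficient (represents-self F)

  twisted-ribbonLoop⇔ : ∀ {F} → Deficiency F c k → RibbonLoop (twist ⁅ e ⁆ F) e ⇔ present ≢ c
  twisted-ribbonLoop⇔ {F = F} = ribbonLoop⇔nondeficient (represents-twist (represents-self F))

  primalType-deficient : ∀ {F τ} → Deficiency F c k → PrimalType F e τ → τ ≡ typeOf c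
  primalType-deficient {absent}    {τ = p} D _            = refl
  primalType-deficient {absent}    {τ = u} D (loop , _)   = contradiction refl (to (ribbonLoop⇔ D) loop)
  primalType-deficient {absent}    {τ = t} D (loop , _)   = contradiction refl (to (ribbonLoop⇔ D) loop)
  primalType-deficient {present}   {τ = p} D ¬loop        = contradiction (from (ribbonLoop⇔ D) λ ()) ¬loop
  primalType-deficient {present}   {τ = u} D _            = refl
  primalType-deficient {present}   {τ = t} D (_ , loop*)  =
    contradiction refl (to (twisted-ribbonLoop⇔ D) loop*)
  primalType-deficient {exclusive} {τ = p} D ¬loop        = contradiction (from (ribbonLoop⇔ D) λ ()) ¬loop
  primalType-deficient {exclusive} {τ = u} D (_ , ¬loop*) =
    contradiction (from (twisted-ribbonLoop⇔ D) λ ()) ¬loop*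
  primalType-deficient {exclusive} {τ = t} D _            = refl

-- The width table

∀-bullet : ∀ {P : Bullet → Set} → P b* → P b× → P b*× → P b×* → P b*×* → ∀ b → P b
∀-bullet p* p× p*× p×* p*×* b*   = p*
∀-bullet p* p× p*× p×* p*×* b×   = p×
∀-bullet p* p× p*× p×* p*×* b*×  = p*×
∀-bullet p* p× p*× p×* p*×* b×*  = p×*
∀-bullet p* p× p*× p×* p*×* b*×* = p*×*

frame : Bullet → Slice × Slice
frame b = act (bulletWord b) (absent , present)

widthChange-table : ∀ c c′ b →
  + (δ absent c + δ absent c′) - + (δ (proj₁ (frame b)) c + δ (dualSlice (proj₂ (frame b))) c′)
    ≡ widthChange (typeOf c) (typeOf c′) b
widthChange-table absent    absent    = ∀-bullet refl refl refl refl refl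
widthChange-table absent    present   = ∀-bullet refl refl refl refl refl
widthChange-table absent    exclusive = ∀-bullet refl refl refl refl refl
widthChange-table present   absent    = ∀-bullet refl refl refl refl refl
widthChange-table present   present   = ∀-bullet refl refl refl refl refl
widthChange-table present   exclusive = ∀-bullet refl refl refl refl refl
widthChange-table exclusive absent    = ∀-bullet refl refl refl refl refl
widthChange-table exclusive present   = ∀-bullet refl refl refl refl refl
widthChange-table exclusive exclusive = ∀-bullet refl refl refl refl refl

shift-difference : ∀ k k′ a b c d →
                   + ((k + a) + (k′ + b)) - + ((k + c) + (k′ + d)) ≡ + (a + b) - + (c + d)
shift-difference k k′ a b c d =
  difference-swap ((k + a) + (k′ + b)) ((k + c) + (k′ + d)) (c + d) (a + b) (rearrange k k′ a b c d)
  where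
  rearrange : ∀ k k′ a b c d → ((k + a) + (k′ + b)) + (c + d) ≡ ((k + c) + (k′ + d)) + (a + b)
  rearrange = solve-∀

mainTheorem6 : ∀ (n : ℕ) (𝓕 : SetSystem n) → IsVfSafe 𝓕 →
    ∀ (e : Fin n) (τ σ : ElemType) → PrimalType 𝓕 e τ → DualType 𝓕 e σ →
    ∀ (b : Bullet) →
      (+ width (applyWord (bulletWord b) e 𝓕)) - (+ width 𝓕) ≡ widthChange τ σ b
mainTheorem6 n 𝓕 vf e τ σ pτ pσ b
  with deficiency e vf | deficiency e (dual-vfSafe vf)
... | c , k , D | c′ , k′ , D′
  with primalType-deficient e D pτ | primalType-deficient e D′ pσ
... | refl | refl = begin
  + width G - + width 𝓕
    ≡⟨ width-difference G 𝓕 (proj₂ (proj₁ (applyWord-deltaMatroid e vf (bulletWord b))))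
                            (proj₂ (proj₁ (vf []))) ⟩
  + (minSize 𝓕 + minSize (dual 𝓕)) - + (minSize G + minSize (dual G))
    ≡⟨ cong₂ (λ s s′ → + s - + s′) (minSizes-represented e (represents-self e 𝓕) D D′)
                                   (minSizes-represented e R D D′) ⟩
  + ((k + δ absent c) + (k′ + δ absent c′)) - + ((k + δ iᵇ c) + (k′ + δ (dualSlice jᵇ) c′))
    ≡⟨ shift-difference k k′ _ _ _ _ ⟩
  + (δ absent c + δ absent c′) - + (δ iᵇ c + δ (dualSlice jᵇ) c′)
    ≡⟨ widthChange-table c c′ b ⟩
  widthChange (typeOf c) (typeOf c′) b ∎
  where
  open ≡-Reasoning
  G = applyWord (bulletWord b) e 𝓕
  iᵇ = proj₁ (frame b)
  jᵇ = proj₂ (frame b)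
  R : Represents e G 𝓕 iᵇ jᵇ
  R = represents-applyWord e (bulletWord b) (represents-self e 𝓕)
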